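{- For all positive integers $m$ and $n$, $PM(n,m)\le \bar{p}(n+1-m)$. Furthermore, when $m>\frac{n}{2}$, $PM(n,m)=\bar{p}(n+1-m)$.
   Context: A partition $\lambda=(\lambda_1\ge\cdots\ge\lambda_\ell)$ of $n$ is a finite nonincreasing sequence of positive integers with sum $n$; $\ell(\lambda)$ is its number of parts. $\bar{p}(N)$ is the number of partitions of $N$ with no parts of size $1$. The hook length $h_{(i,j)}(\lambda)$ of a cell $(i,j)$ of the Ferrers diagram is the number of cells consisting of the cell itself, the cells to its right in its row and the cells below it in its column. A numerical set is a subset $S\subseteq\mathbb{N}_0$ containing $0$ with finite complement; a numerical semigroup is a numerical set closed under addition. For a partition $\lambda$ let $S_\lambda=\mathbb{N}_0\setminus\{h_{(i,1)}(\lambda):1\le i\le\ell(\lambda)\}$; its multiplicity (smallest positive element) is one more than the number of parts of $\lambda$ equal to $1$. $PM(n,m)$ is the number of partitions $\lambda$ of $n$ having exactly $m-1$ parts equal to $1$ such that $S_\lambda$ is a numerical semigroup. -}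

module Defs where

open import Data.Nat using (ℕ; zero; suc; _+_; _∸_; _≤_; _<_; _≤?_; _≥_; s≤s; z≤n)
open import Data.Nat.Properties using (_≟_; ≤-refl; ≤-trans; m≤m+n; m≤n+m; +-monoʳ-≤; m+n≤o⇒m≤o; m+n≤o⇒n≤o; ≤-pred)
open import Data.Integer using (ℤ; +_; -[1+_])
open import Data.Nat.ListAction using (sum)
open import Data.List using (List; []; _∷_; length; filter; map; concatMap; upTo; applyUpTo)
open import Data.List.Relation.Unary.All using (All; all?)
open import Data.List.Relation.Unary.Any using (here; there)
open import Data.List.Relation.Unary.Linked using (Linked; linked?)
open import Data.List.Membership.Propositional using (_∈_; _∉_)
open import Data.List.Membership.DecPropositional _≟_ using (_∉?_; _∈?_)
open import Data.Fin using (Fin; toℕ; fromℕ<)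
open import Data.Fin.Properties using (toℕ-fromℕ<; toℕ<n) renaming (all? to allFin?)
open import Data.Product using (Σ; _×_; _,_; ∃)
open import Relation.Nullary using (Dec; yes; no; ¬_; _×-dec_)
open import Relation.Nullary.Decidable using (map′)
open import Relation.Binary.PropositionalEquality using (_≡_; refl; subst; sym)
open import Function using (_∘_)

IsPartition : ℕ → List ℕ → Set
IsPartition n λs = (sum λs ≡ n) × All (1 ≤_) λs × Linked _≥_ λs

isPartition? : (n : ℕ) (λs : List ℕ) → Dec (IsPartition n λs)
isPartition? n λs = (sum λs ≟ n) ×-dec (all? (1 ≤?_) λs ×-dec linked? (λ a b → b ≤? a) λs)

listsOfLength : ℕ → ℕ → List (List ℕ)
listsOfLength n zero = [] ∷ []
listsOfLength n (suc k) =
  concatMap (λ x → map (x ∷_) (listsOfLength n k)) (applyUpTo suc n)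

-- all lists of length ≤ n with entries in {1,…,n}; each occurs exactly once.
-- Every partition of n is among them (it has ≤ n parts, each ≤ n).
candidates : ℕ → List (List ℕ)
candidates n = concatMap (listsOfLength n) (applyUpTo (λ k → k) (suc n))

countBy : {A : Set} {P : A → Set} → ((a : A) → Dec (P a)) → List A → ℕ
countBy P? xs = length (filter P? xs)

onesCount : List ℕ → ℕ
onesCount λs = length (filter (_≟ 1) λs)

NoOnes : List ℕ → Set
NoOnes λs = All (λ x → ¬ (x ≡ 1)) λs

pbar : ℕ → ℕ
pbar N = countBy (λ λs → isPartition? N λs ×-dec all? (λ x → ¬? (x ≟ 1)) λs) (candidates N)
  where
  ¬? : {P : Set} → Dec P → Dec (¬ P)
  ¬? (yes p) = no (λ f → f p)
  ¬? (no q) = yes q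

-- p̄ on integers: there are no partitions of a negative integer
pbarℤ : ℤ → ℕ
pbarℤ (+ N) = pbar N
pbarℤ -[1+ N ] = 0

-- Hook lengths (cells are 1-indexed (i , j))

-- i-th part (1-indexed), 0 outside the range
part : List ℕ → ℕ → ℕ
part [] i = 0
part (x ∷ xs) zero = 0
part (x ∷ xs) (suc zero) = x
part (x ∷ xs) (suc (suc i)) = part xs (suc i)

column : List ℕ → ℕ → ℕ
column λs j = length (filter (j ≤?_) λs)

-- hook length of cell (i , j): arm + leg + 1
hook : List ℕ → ℕ → ℕ → ℕ
hook λs i j = (part λs i ∸ j) + (column λs j ∸ i) + 1

firstColumnHooks : List ℕ → List ℕ
firstColumnHooks λs = applyUpTo (λ k → hook λs (suc k) 1) (length λs)

Sλ : List ℕ → ℕ → Set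
Sλ λs x = x ∉ firstColumnHooks λs

IsNumericalSet : (ℕ → Set) → Set
IsNumericalSet S = S 0 × ∃ (λ N → ∀ x → N ≤ x → S x)

IsNumericalSemigroup : (ℕ → Set) → Set
IsNumericalSemigroup S = IsNumericalSet S × (∀ a b → S a → S b → S (a + b))

∈⇒≤sum : ∀ {x} (xs : List ℕ) → x ∈ xs → x ≤ sum xs
∈⇒≤sum (y ∷ ys) (here refl) = m≤m+n y (sum ys)
∈⇒≤sum (y ∷ ys) (there p) = ≤-trans (∈⇒≤sum ys p) (m≤n+m (sum ys) y)

module _ (H : List ℕ) where
  private
    M = sum H
    S : ℕ → Set
    S x = x ∉ H

    Bounded : Set
    Bounded = (a b : Fin (suc M)) → S (toℕ a) → S (toℕ b) → S (toℕ a + toℕ b)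

    imp : {P Q : Set} → Dec P → Dec Q → Dec (P → Q)
    imp (yes p) (yes q) = yes (λ _ → q)
    imp (yes p) (no ¬q) = no (λ f → ¬q (f p))
    imp (no ¬p) _ = yes (λ p → Relation.Nullary.contradiction p ¬p)
      where import Relation.Nullary

    bounded? : Dec Bounded
    bounded? = allFin? (λ a → allFin? (λ b →
      imp (toℕ a ∉? H) (imp (toℕ b ∉? H) (toℕ a + toℕ b ∉? H))))

    cofinite : ∀ x → suc M ≤ x → S x
    cofinite x le x∈ with ≤-trans le (∈⇒≤sum H x∈)
    ... | q = Data.Nat.Properties.<-irrefl refl q
      where import Data.Nat.Properties

    toClosed : Bounded → ∀ a b → S a → S b → S (a + b)
    toClosed B a b sa sb ab∈ =
      let le = ∈⇒≤sum H ab∈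
          a< = s≤s (m+n≤o⇒m≤o a le)
          b< = s≤s (m+n≤o⇒n≤o a le)
          r = B (fromℕ< a<) (fromℕ< b<)
                (subst S (sym (toℕ-fromℕ< a<)) sa)
                (subst S (sym (toℕ-fromℕ< b<)) sb)
      in r (subst (_∈ H) (sym (Relation.Binary.PropositionalEquality.cong₂ _+_
              (toℕ-fromℕ< a<) (toℕ-fromℕ< b<))) ab∈)
      where import Relation.Binary.PropositionalEquality

  isNumericalSemigroup? : Dec (IsNumericalSemigroup (λ x → x ∉ H))
  isNumericalSemigroup? with 0 ∉? H | bounded?
  ... | no ¬0 | _ = no (λ { ((s0 , _) , _) → ¬0 s0 })
  ... | yes s0 | no ¬B = no (λ { (_ , cl) → ¬B (λ a b → cl (toℕ a) (toℕ b)) })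
  ... | yes s0 | yes B = yes ((s0 , (suc M , cofinite)) , toClosed B)

PM : ℕ → ℕ → ℕ
PM n m = countBy
  (λ λs → isPartition? n λs ×-dec
          ((onesCount λs ≟ m ∸ 1) ×-dec isNumericalSemigroup? (firstColumnHooks λs)))
  (candidates n)

module Submission where

-- A partition of n with exactly r = m − 1 parts equal to 1 is μ ++ 1^r for a unique partition μ of
-- n − r without ones, so PM(n, m) ≤ p̄(n − r).  Conversely, the first-column hooks of μ ++ 1^r include
-- 1, …, r (the hooks of the trailing ones) and are all at most n.  When n < 2m, every gap of S_λ thus lies
-- in [1, 2m) and 1, …, m − 1 are gaps, so every nonzero element of S_λ is at least m and a sum of two
-- of them is at least 2m, beyond every gap: S_λ is a numerical semigroup for every such μ.

open import Defs
open import Data.Nat using (ℕ; zero; suc; _+_; _*_; _∸_; _≤_; _<_; _≥_; _≤?_; s≤s; z≤n)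
open import Data.Nat.Properties
open import Data.Nat.ListAction using (sum)
open import Data.Nat.ListAction.Properties using (sum-++)
open import Data.Integer using (+_; _-_; _⊖_)
import Data.Integer.Properties as ℤ
open import Data.List using (List; []; _∷_; _++_; length; filter; map; concatMap; applyUpTo; applyDownFrom; replicate)
open import Data.List.Properties
  using (length-++; length-map; length-filter; length-replicate; filter-++; filter-all; filter-none; filter-reject;
         filter-≐; ++-cancelʳ; ∷-injectiveˡ; ∷-injectiveʳ)
open import Data.List.Relation.Unary.All as All using (All; []; _∷_)
import Data.List.Relation.Unary.All.Properties as All
open import Data.List.Relation.Unary.AllPairs as AllPairs using ([]; _∷_)
import Data.List.Relation.Unary.AllPairs.Properties as AllPairs
open import Data.List.Relation.Unary.Any using (here; there)
open import Data.List.Relation.Unary.Linked as Linked using (Linked; []; [-]; _∷_)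
open import Data.List.Relation.Unary.Unique.Propositional using (Unique)
import Data.List.Relation.Unary.Unique.Propositional.Properties as Unique
open import Data.List.Relation.Binary.Disjoint.Propositional using (Disjoint)
open import Data.List.Relation.Binary.Subset.Propositional using (_⊆_)
open import Data.List.Membership.Propositional using (_∈_; _∉_; lose; find)
open import Data.List.Membership.Propositional.Properties
  using (∈-++⁺ˡ; ∈-++⁺ʳ; ∈-++⁻; ∈-∃++; ∈-map⁺; ∈-map⁻; ∈-filter⁺; ∈-filter⁻; ∈-concatMap⁺; ∈-concatMap⁻;
         ∈-applyUpTo⁺; ∈-applyDownFrom⁺; map∷⁻)
open import Data.Product using (∃; _×_; _,_; proj₁; proj₂)
open import Data.Sum using (inj₁; inj₂)
open import Function using (id; _∘_)
open import Relation.Nullary using (Dec; yes; no; ¬_; _×-dec_; contradiction)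
open import Relation.Nullary.Decidable using (¬?)
open import Relation.Unary using (Decidable)
open import Relation.Binary.PropositionalEquality
  using (_≡_; _≢_; refl; sym; trans; cong; cong₂; subst; module ≡-Reasoning)

private
  variable
    A B : Set
    x h n r N : ℕ
    xs ys l μ : List ℕ

unique-⊆⇒length≤ : {as bs : List A} → Unique as → as ⊆ bs → length as ≤ length bs
unique-⊆⇒length≤ {as = []} _ _ = z≤n
unique-⊆⇒length≤ {as = a ∷ as} (a∉as ∷ as!) as⊆bs with ∈-∃++ (as⊆bs (here refl))
... | bs₁ , bs₂ , refl = begin
  suc (length as)             ≤⟨ s≤s (unique-⊆⇒length≤ as! as⊆bs₁++bs₂) ⟩
  suc (length (bs₁ ++ bs₂))   ≡⟨ length-removed ⟨
  length (bs₁ ++ a ∷ bs₂)     ∎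
  where
  open ≤-Reasoning
  length-removed : length (bs₁ ++ a ∷ bs₂) ≡ suc (length (bs₁ ++ bs₂))
  length-removed = begin-equality
    length (bs₁ ++ a ∷ bs₂)          ≡⟨ length-++ bs₁ ⟩
    length bs₁ + suc (length bs₂)    ≡⟨ +-suc (length bs₁) (length bs₂) ⟩
    suc (length bs₁ + length bs₂)    ≡⟨ cong suc (length-++ bs₁) ⟨
    suc (length (bs₁ ++ bs₂))        ∎
  as⊆bs₁++bs₂ : as ⊆ bs₁ ++ bs₂
  as⊆bs₁++bs₂ {v} v∈as with ∈-++⁻ bs₁ (as⊆bs (there v∈as))
  ... | inj₁ v∈bs₁ = ∈-++⁺ˡ v∈bs₁
  ... | inj₂ (there v∈bs₂) = ∈-++⁺ʳ bs₁ v∈bs₂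
  ... | inj₂ (here refl) = contradiction refl (All.lookup a∉as v∈as)

Unique-concatMap⁺ : (g : A → List B) {as : List A} →
  (∀ a → Unique (g a)) → (∀ {a b} → a ≢ b → Disjoint (g a) (g b)) →
  Unique as → Unique (concatMap g as)
Unique-concatMap⁺ g g! disjoint as! =
  Unique.concat⁺ (All.map⁺ (All.universal g! _)) (AllPairs.map⁺ (AllPairs.map disjoint as!))

∈-concatMap : (g : A → List B) {as : List A} {a : A} {b : B} →
  a ∈ as → b ∈ g a → b ∈ concatMap g as
∈-concatMap g a∈as b∈ga = ∈-concatMap⁺ g (lose a∈as b∈ga)

listsOfLength-length : ∀ n k → l ∈ listsOfLength n k → length l ≡ k
listsOfLength-length n zero (here refl) = refl
listsOfLength-length n (suc k) l∈
  with _ , _ , l∈a∷ ← find (∈-concatMap⁻ _ {xs = applyUpTo suc n} l∈)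
  with _ , l′∈ , refl ← map∷⁻ l∈a∷ = cong suc (listsOfLength-length n k l′∈)

listsOfLength-unique : ∀ n k → Unique (listsOfLength n k)
listsOfLength-unique n zero = [] ∷ []
listsOfLength-unique n (suc k) = Unique-concatMap⁺ _
  (λ a → Unique.map⁺ ∷-injectiveʳ (listsOfLength-unique n k))
  distinctHeads
  (Unique.applyUpTo⁺₁ suc n (λ i<j _ → <⇒≢ i<j ∘ suc-injective))
  where
  distinctHeads : ∀ {a b} → a ≢ b →
    Disjoint (map (a ∷_) (listsOfLength n k)) (map (b ∷_) (listsOfLength n k))
  distinctHeads a≢b (v∈a∷ , v∈b∷) with _ , _ , refl ← map∷⁻ v∈a∷ with _ , _ , eq ← map∷⁻ v∈b∷ =
    a≢b (∷-injectiveˡ eq)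

∈-listsOfLength : All (1 ≤_) l → All (_≤ n) l → l ∈ listsOfLength n (length l)
∈-listsOfLength [] [] = here refl
∈-listsOfLength {l = suc x ∷ l} (_ ∷ pos) (x<n ∷ bounded) =
  ∈-concatMap _ (∈-applyUpTo⁺ suc x<n) (∈-map⁺ (suc x ∷_) (∈-listsOfLength pos bounded))

candidates-unique : ∀ n → Unique (candidates n)
candidates-unique n = Unique-concatMap⁺ (listsOfLength n) (listsOfLength-unique n)
  (λ a≢b (v∈a , v∈b) → a≢b (trans (sym (listsOfLength-length n _ v∈a)) (listsOfLength-length n _ v∈b)))
  (Unique.upTo⁺ (suc n))

length≤sum : All (1 ≤_) l → length l ≤ sum l
length≤sum [] = z≤n
length≤sum (1≤x ∷ pos) = +-mono-≤ 1≤x (length≤sum pos)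

isPartition⇒∈candidates : IsPartition n l → l ∈ candidates n
isPartition⇒∈candidates {l = l} (refl , pos , _) =
  ∈-concatMap (listsOfLength _) (∈-applyUpTo⁺ id (s≤s (length≤sum pos)))
    (∈-listsOfLength pos (All.tabulate (∈⇒≤sum l)))

sum-replicate-1 : ∀ r → sum (replicate r 1) ≡ r
sum-replicate-1 zero = refl
sum-replicate-1 (suc r) = cong suc (sum-replicate-1 r)

onesCount-replicate-1 : ∀ r → onesCount (replicate r 1) ≡ r
onesCount-replicate-1 zero = refl
onesCount-replicate-1 (suc r) = cong suc (onesCount-replicate-1 r)

onesCount-++-replicate-1 : NoOnes μ → onesCount (μ ++ replicate r 1) ≡ r
onesCount-++-replicate-1 {μ = μ} {r = r} noOnes = begin
  length (filter (_≟ 1) (μ ++ replicate r 1))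
    ≡⟨ cong length (filter-++ (_≟ 1) μ _) ⟩
  length (filter (_≟ 1) μ ++ filter (_≟ 1) (replicate r 1))
    ≡⟨ cong (λ ν → length (ν ++ _)) (filter-none (_≟ 1) noOnes) ⟩
  onesCount (replicate r 1)
    ≡⟨ onesCount-replicate-1 r ⟩
  r ∎
  where open ≡-Reasoning

headed-by-1⇒replicate-1 : All (1 ≤_) l → Linked _≥_ (1 ∷ l) → l ≡ replicate (length l) 1
headed-by-1⇒replicate-1 [] _ = refl
headed-by-1⇒replicate-1 (1≤x ∷ pos) (x≤1 ∷ linked) with ≤-antisym x≤1 1≤x
... | refl = cong (1 ∷_) (headed-by-1⇒replicate-1 pos linked)

splitOnes : All (1 ≤_) l → Linked _≥_ l → ∃ λ μ → NoOnes μ × l ≡ μ ++ replicate (onesCount l) 1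
splitOnes {l = []} _ _ = [] , [] , refl
splitOnes {l = x ∷ l} (_ ∷ pos) linked with x ≟ 1
... | yes refl = [] , [] , cong (1 ∷_) (trans l≡ones (cong (λ k → replicate k 1) length≡onesCount))
  where
  l≡ones : l ≡ replicate (length l) 1
  l≡ones = headed-by-1⇒replicate-1 pos linked
  length≡onesCount : length l ≡ onesCount l
  length≡onesCount = trans (sym (onesCount-replicate-1 (length l))) (cong onesCount (sym l≡ones))
... | no x≢1 with μ , noOnes , l≡μ++ones ← splitOnes pos (Linked.tail linked) =
  x ∷ μ , x≢1 ∷ noOnes ,
  cong (x ∷_) (trans l≡μ++ones (cong (λ k → μ ++ replicate k 1) onesCount-skips-x))
  where
  onesCount-skips-x : onesCount l ≡ onesCount (x ∷ l)
  onesCount-skips-x = cong length (sym (filter-reject (_≟ 1) x≢1))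

Linked-++⁻ˡ : ∀ xs → Linked _≥_ (xs ++ ys) → Linked _≥_ xs
Linked-++⁻ˡ [] _ = []
Linked-++⁻ˡ (x ∷ []) _ = [-]
Linked-++⁻ˡ (x ∷ y ∷ xs) (x≥y ∷ linked) = x≥y ∷ Linked-++⁻ˡ (y ∷ xs) linked

Linked-replicate-1 : ∀ r → Linked _≥_ (replicate r 1)
Linked-replicate-1 zero = []
Linked-replicate-1 (suc zero) = [-]
Linked-replicate-1 (suc (suc r)) = ≤-refl ∷ Linked-replicate-1 (suc r)

Linked-++-replicate-1 : All (1 ≤_) μ → Linked _≥_ μ → Linked _≥_ (μ ++ replicate r 1)
Linked-++-replicate-1 {r = r} [] [] = Linked-replicate-1 r
Linked-++-replicate-1 {r = zero} (_ ∷ []) [-] = [-]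
Linked-++-replicate-1 {r = suc r} (1≤x ∷ []) [-] = 1≤x ∷ Linked-replicate-1 (suc r)
Linked-++-replicate-1 (_ ∷ pos) (x≥y ∷ linked) = x≥y ∷ Linked-++-replicate-1 pos linked

sum-++-replicate-1 : ∀ μ r → sum (μ ++ replicate r 1) ≡ sum μ + r
sum-++-replicate-1 μ r = trans (sum-++ μ (replicate r 1)) (cong (λ k → sum μ + k) (sum-replicate-1 r))

isPartition-++-replicate-1⁺ : IsPartition N μ → IsPartition (N + r) (μ ++ replicate r 1)
isPartition-++-replicate-1⁺ {μ = μ} {r = r} (refl , pos , linked) =
  sum-++-replicate-1 μ r , All.++⁺ pos (All.replicate⁺ r ≤-refl) , Linked-++-replicate-1 pos linked

isPartition-++-replicate-1⁻ : IsPartition (N + r) (μ ++ replicate r 1) → IsPartition N μ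
isPartition-++-replicate-1⁻ {N = N} {r = r} {μ = μ} (sum≡ , pos , linked) =
  +-cancelʳ-≡ r (sum μ) N (trans (sym (sum-++-replicate-1 μ r)) sum≡) ,
  All.++⁻ˡ μ pos ,
  Linked-++⁻ˡ μ linked

column-1 : All (1 ≤_) l → column l 1 ≡ length l
column-1 pos = cong length (filter-all (1 ≤?_) pos)

firstColumnHooks-∷ : All (1 ≤_) (x ∷ xs) → firstColumnHooks (x ∷ xs) ≡ x + length xs ∷ firstColumnHooks xs
firstColumnHooks-∷ {x = suc y} {xs = xs} pos@(_ ∷ pos′) = begin
  firstColumnHooks (suc y ∷ xs)              ≡⟨ cong hooksWithColumn (column-1 pos) ⟩
  hooksWithColumn (suc (length xs))
    ≡⟨ cong₂ _∷_ (+-comm (y + length xs) 1) (cong tailHooks (sym (column-1 pos′))) ⟩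
  suc y + length xs ∷ firstColumnHooks xs    ∎
  where
  open ≡-Reasoning
  tailHooks : ℕ → List ℕ
  tailHooks c = applyUpTo (λ k → (part xs (suc k) ∸ 1) + (c ∸ suc k) + 1) (length xs)
  hooksWithColumn : ℕ → List ℕ
  hooksWithColumn c = y + (c ∸ 1) + 1 ∷ tailHooks (c ∸ 1)

firstColumnHooks-bounded : All (1 ≤_) l → h ∈ firstColumnHooks l → 1 ≤ h × h ≤ sum l
firstColumnHooks-bounded {l = x ∷ xs} {h = h} pos@(1≤x ∷ pos′) h∈
  with subst (h ∈_) (firstColumnHooks-∷ pos) h∈
... | here refl = ≤-trans 1≤x (m≤m+n x (length xs)) , +-monoʳ-≤ x (length≤sum pos′)
... | there h∈′ with 1≤h , h≤sum ← firstColumnHooks-bounded pos′ h∈′ =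
  1≤h , ≤-trans h≤sum (m≤n+m (sum xs) x)

firstColumnHooks-++⁺ʳ : ∀ xs → All (1 ≤_) (xs ++ ys) →
  h ∈ firstColumnHooks ys → h ∈ firstColumnHooks (xs ++ ys)
firstColumnHooks-++⁺ʳ [] _ h∈ = h∈
firstColumnHooks-++⁺ʳ {h = h} (x ∷ xs) pos@(_ ∷ pos′) h∈ =
  subst (h ∈_) (sym (firstColumnHooks-∷ pos)) (there (firstColumnHooks-++⁺ʳ xs pos′ h∈))

firstColumnHooks-replicate-1 : ∀ r → firstColumnHooks (replicate r 1) ≡ applyDownFrom suc r
firstColumnHooks-replicate-1 zero = refl
firstColumnHooks-replicate-1 (suc r) =
  trans (firstColumnHooks-∷ (All.replicate⁺ (suc r) ≤-refl))
        (cong₂ _∷_ (cong suc (length-replicate r)) (firstColumnHooks-replicate-1 r))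

∈-firstColumnHooks-++-replicate-1 : All (1 ≤_) μ → 1 ≤ x → x ≤ r → x ∈ firstColumnHooks (μ ++ replicate r 1)
∈-firstColumnHooks-++-replicate-1 {μ = μ} {x = suc y} {r = r} pos _ y<r =
  firstColumnHooks-++⁺ʳ μ (All.++⁺ pos (All.replicate⁺ r ≤-refl))
    (subst (suc y ∈_) (sym (firstColumnHooks-replicate-1 r)) (∈-applyDownFrom⁺ suc y<r))

isNumericalSemigroup-of-gaps : ∀ {H : List ℕ} m →
  (∀ {h} → h ∈ H → 1 ≤ h × h < 2 * m) → (∀ {x} → 1 ≤ x → x < m → x ∈ H) →
  IsNumericalSemigroup (_∉ H)
isNumericalSemigroup-of-gaps {H} m gap⇒bounded small⇒gap = (0∉H , 2 * m , large∉H) , closed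
  where
  0∉H : 0 ∉ H
  0∉H 0∈H = contradiction (proj₁ (gap⇒bounded 0∈H)) λ ()
  large∉H : ∀ x → 2 * m ≤ x → x ∉ H
  large∉H x 2m≤x x∈H = <⇒≱ (proj₂ (gap⇒bounded x∈H)) 2m≤x
  nonzero-element⇒m≤ : ∀ x → suc x ∉ H → m ≤ suc x
  nonzero-element⇒m≤ x x∉H with m ≤? suc x
  ... | yes m≤ = m≤
  ... | no m≰ = contradiction (small⇒gap (s≤s z≤n) (≰⇒> m≰)) x∉H
  closed : ∀ a b → a ∉ H → b ∉ H → a + b ∉ H
  closed zero b _ b∉H = b∉H
  closed (suc a) zero a∉H _ = subst (_∉ H) (sym (+-identityʳ (suc a))) a∉H
  closed (suc a) (suc b) a∉H b∉H = large∉H (suc a + suc b)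
    (subst (_≤ suc a + suc b) (cong (λ k → m + k) (sym (+-identityʳ m)))
      (+-mono-≤ (nonzero-element⇒m≤ a a∉H) (nonzero-element⇒m≤ b b∉H)))

PartitionWithoutOnes : ℕ → List ℕ → Set
PartitionWithoutOnes N l = IsPartition N l × NoOnes l

partitionWithoutOnes? : ∀ N → Decidable (PartitionWithoutOnes N)
partitionWithoutOnes? N l = isPartition? N l ×-dec All.all? (λ x → ¬? (x ≟ 1)) l

partitionsWithoutOnes : ℕ → List (List ℕ)
partitionsWithoutOnes N = filter (partitionWithoutOnes? N) (candidates N)

∈-partitionsWithoutOnes⁺ : PartitionWithoutOnes N μ → μ ∈ partitionsWithoutOnes N
∈-partitionsWithoutOnes⁺ {N = N} μ-ok = ∈-filter⁺ (partitionWithoutOnes? N) (isPartition⇒∈candidates (proj₁ μ-ok)) μ-ok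

∈-partitionsWithoutOnes⁻ : μ ∈ partitionsWithoutOnes N → PartitionWithoutOnes N μ
∈-partitionsWithoutOnes⁻ {N = N} μ∈ = proj₂ (∈-filter⁻ (partitionWithoutOnes? N) {xs = candidates N} μ∈)

-- The decision procedure inside pbar is local to its definition; unification is the only way to name it.
pbar-counts-filter : ∀ N → ∃ λ (≢1? : Decidable (_≢ 1)) →
  pbar N ≡ length (filter (λ l → isPartition? N l ×-dec All.all? ≢1? l) (candidates N))
pbar-counts-filter N = _ , refl

pbar≡length-partitionsWithoutOnes : ∀ N → pbar N ≡ length (partitionsWithoutOnes N)
pbar≡length-partitionsWithoutOnes N with ≢1? , pbar≡ ← pbar-counts-filter N =
  trans pbar≡ (cong length (filter-≐ (λ l → isPartition? N l ×-dec All.all? ≢1? l) (partitionWithoutOnes? N)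
                                      (id , id) (candidates N)))

SemigroupPartition : ℕ → ℕ → List ℕ → Set
SemigroupPartition n r l = IsPartition n l × onesCount l ≡ r × IsNumericalSemigroup (Sλ l)

semigroupPartition? : ∀ n r → Decidable (SemigroupPartition n r)
semigroupPartition? n r l =
  isPartition? n l ×-dec ((onesCount l ≟ r) ×-dec isNumericalSemigroup? (firstColumnHooks l))

semigroupPartitions : ℕ → ℕ → List (List ℕ)
semigroupPartitions n r = filter (semigroupPartition? n r) (candidates n)

∈-semigroupPartitions⁺ : SemigroupPartition n r l → l ∈ semigroupPartitions n r
∈-semigroupPartitions⁺ {n = n} {r = r} l-ok =
  ∈-filter⁺ (semigroupPartition? n r) (isPartition⇒∈candidates (proj₁ l-ok)) l-ok

∈-semigroupPartitions⁻ : l ∈ semigroupPartitions n r → SemigroupPartition n r l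
∈-semigroupPartitions⁻ {n = n} {r = r} l∈ = proj₂ (∈-filter⁻ (semigroupPartition? n r) {xs = candidates n} l∈)

isPartition-splitOnes : IsPartition (N + r) l → onesCount l ≡ r →
  ∃ λ μ → PartitionWithoutOnes N μ × l ≡ μ ++ replicate r 1
isPartition-splitOnes partition@(_ , pos , linked) refl with μ , noOnes , l≡ ← splitOnes pos linked =
  μ , (isPartition-++-replicate-1⁻ (subst (IsPartition _) l≡ partition) , noOnes) , l≡

Sλ-++-replicate-1-isNumericalSemigroup : IsPartition n (μ ++ replicate r 1) → n < 2 * suc r →
  IsNumericalSemigroup (Sλ (μ ++ replicate r 1))
Sλ-++-replicate-1-isNumericalSemigroup {μ = μ} (refl , pos , _) n<2m =
  isNumericalSemigroup-of-gaps (suc _)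
    (λ h∈ → let 1≤h , h≤n = firstColumnHooks-bounded pos h∈ in 1≤h , ≤-<-trans h≤n n<2m)
    (λ 1≤x x<m → ∈-firstColumnHooks-++-replicate-1 (All.++⁻ˡ μ pos) 1≤x (≤-pred x<m))

PM≤pbar : r ≤ n → PM n (suc r) ≤ pbar (n ∸ r)
PM≤pbar {r = r} {n = n} r≤n = begin
  length (semigroupPartitions n r)          ≤⟨ unique-⊆⇒length≤ semigroupPartitions-unique stripOnes ⟩
  length (map (_++ replicate r 1) μs)       ≡⟨ length-map _ μs ⟩
  length μs                                 ≡⟨ pbar≡length-partitionsWithoutOnes (n ∸ r) ⟨
  pbar (n ∸ r)                              ∎
  where
  open ≤-Reasoning
  μs : List (List ℕ)
  μs = partitionsWithoutOnes (n ∸ r)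
  semigroupPartitions-unique : Unique (semigroupPartitions n r)
  semigroupPartitions-unique = Unique.filter⁺ (semigroupPartition? n r) (candidates-unique n)
  n≡n∸r+r : n ≡ n ∸ r + r
  n≡n∸r+r = sym (m∸n+n≡m r≤n)
  stripOnes : semigroupPartitions n r ⊆ map (_++ replicate r 1) μs
  stripOnes l∈ with partition , ones≡r , _ ← ∈-semigroupPartitions⁻ l∈
    with μ , μ-ok , refl ← isPartition-splitOnes (subst (λ k → IsPartition k _) n≡n∸r+r partition) ones≡r =
    ∈-map⁺ _ (∈-partitionsWithoutOnes⁺ μ-ok)

pbar≤PM : r ≤ n → n < 2 * suc r → pbar (n ∸ r) ≤ PM n (suc r)
pbar≤PM {r = r} {n = n} r≤n n<2m = begin
  pbar (n ∸ r)                              ≡⟨ pbar≡length-partitionsWithoutOnes (n ∸ r) ⟩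
  length μs                                 ≡⟨ length-map _ μs ⟨
  length (map (_++ replicate r 1) μs)       ≤⟨ unique-⊆⇒length≤ appended-unique addOnes ⟩
  length (semigroupPartitions n r)          ∎
  where
  open ≤-Reasoning
  μs : List (List ℕ)
  μs = partitionsWithoutOnes (n ∸ r)
  appended-unique : Unique (map (_++ replicate r 1) μs)
  appended-unique = Unique.map⁺ (++-cancelʳ (replicate r 1) _ _)
    (Unique.filter⁺ (partitionWithoutOnes? (n ∸ r)) (candidates-unique (n ∸ r)))
  addOnes : map (_++ replicate r 1) μs ⊆ semigroupPartitions n r
  addOnes l∈ with μ , μ∈ , refl ← ∈-map⁻ _ l∈
    with μ-partition , noOnes ← ∈-partitionsWithoutOnes⁻ μ∈ =
    ∈-semigroupPartitions⁺
      (partition , onesCount-++-replicate-1 noOnes , Sλ-++-replicate-1-isNumericalSemigroup partition n<2m)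
    where
    partition : IsPartition n (μ ++ replicate r 1)
    partition = subst (λ k → IsPartition k _) (m∸n+n≡m r≤n) (isPartition-++-replicate-1⁺ μ-partition)

PM≡0 : n < r → PM n (suc r) ≡ 0
PM≡0 {n = n} {r = r} n<r =
  cong length (filter-none (semigroupPartition? n r) (All.universal tooManyOnes (candidates n)))
  where
  tooManyOnes : ∀ l → ¬ SemigroupPartition n r l
  tooManyOnes l ((refl , pos , _) , refl , _) = <⇒≱ n<r (≤-trans (length-filter (_≟ 1) l) (length≤sum pos))

[n+1]-[1+r]≡n⊖r : ∀ n r → (+ n Data.Integer.+ + 1) - + suc r ≡ n ⊖ r
[n+1]-[1+r]≡n⊖r n r = begin
  + (n + 1) - + suc r   ≡⟨ ℤ.m-n≡m⊖n (n + 1) (suc r) ⟩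
  (n + 1) ⊖ suc r       ≡⟨ cong (_⊖ suc r) (+-comm n 1) ⟩
  suc n ⊖ suc r         ≡⟨ ℤ.[1+m]⊖[1+n]≡m⊖n n r ⟩
  n ⊖ r                 ∎
  where open ≡-Reasoning

pbarℤ-⊖-≥ : r ≤ n → pbarℤ (n ⊖ r) ≡ pbar (n ∸ r)
pbarℤ-⊖-≥ r≤n = cong pbarℤ (ℤ.⊖-≥ r≤n)

pbarℤ-⊖-< : n < r → pbarℤ (n ⊖ r) ≡ 0
pbarℤ-⊖-< {n = n} {r = r} n<r rewrite ℤ.⊖-< n<r with r ∸ n | m<n⇒0<n∸m n<r
... | suc _ | _ = refl

proposition5p1 : (m n : ℕ) → 1 ≤ m → 1 ≤ n →
    (PM n m ≤ pbarℤ ((+ n Data.Integer.+ + 1) - + m))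
    × (n < 2 * m → PM n m ≡ pbarℤ ((+ n Data.Integer.+ + 1) - + m))
proposition5p1 (suc r) n _ _ = subst (PMbounds ∘ pbarℤ) (sym ([n+1]-[1+r]≡n⊖r n r)) (bounds (r ≤? n))
  where
  PMbounds : ℕ → Set
  PMbounds p = PM n (suc r) ≤ p × (n < 2 * suc r → PM n (suc r) ≡ p)
  bounds : Dec (r ≤ n) → PMbounds (pbarℤ (n ⊖ r))
  bounds (yes r≤n) = subst PMbounds (sym (pbarℤ-⊖-≥ r≤n))
    (PM≤pbar r≤n , λ n<2m → ≤-antisym (PM≤pbar r≤n) (pbar≤PM r≤n n<2m))
  bounds (no r≰n) = subst PMbounds (sym (pbarℤ-⊖-< (≰⇒> r≰n)))
    (≤-reflexive (PM≡0 (≰⇒> r≰n)) , λ _ → PM≡0 (≰⇒> r≰n))
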